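{- Every proof in $\mathsf{QK}(\mathcal{C})\mathsf{L}$ of a labeled tree sequent is a labeled tree derivation with the fixed root property.
   Context: Labeled sequents are $\mathcal{R},\Gamma\vdash\Delta$ with $\mathcal{R}$ a multiset of relational atoms $wRu$ and domain atoms $x\in D(w)$ and $\Gamma,\Delta$ multisets of labeled formulae $w:\phi$ (first-order modal formulae with $\neg,\lor,\Diamond,\exists$, $\bot$). A labeled tree sequent is one whose relational atoms form a (labeled) tree and in which every label occurs in the relational atoms, or all labels are identical if there are no relational atoms. A labeled tree derivation is a proof containing only labeled tree sequents; it has the fixed root property iff every sequent in it has the same root. $\mathcal{C}$ is a set of frame conditions (seriality $S$, path conditions $G(n,k)$, increasing/decreasing/constant domains $I_d,D_d,C_d$, non-empty domains $N_d$). $\mathsf{QK}(\mathcal{C})\mathsf{L}$ consists of: $(ax)$ $\mathcal{R},\Gamma,w:p(\vec{x})\vdash w:p(\vec{x}),\Delta$; $(\bot_l)$; left/right rules for $\neg,\lor$ (acting on formulae at a fixed label); $(\Diamond_l)$: from $\mathcal{R},wRu,\Gamma,u:\phi\vdash\Delta$ infer $\mathcal{R},\Gamma,w:\Diamond\phi\vdash\Delta$ ($u$ fresh); $(\exists_l)$: from $\mathcal{R},y\in D(w),\Gamma,w:\phi[y/x]\vdash\Delta$ infer $\mathcal{R},\Gamma,w:\exists x\phi\vdash\Delta$ ($y$ fresh); $(d)$, only if $S\in\mathcal{C}$: from $\mathcal{R},wRu,\Gamma\vdash\Delta$ infer $\mathcal{R},\Gamma\vdash\Delta$ ($u$ fresh);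 and the reachability rules $(p_{\Diamond})$ (from $\mathcal{R},\Gamma\vdash w:\Diamond\phi,u:\phi,\Delta$ infer $\mathcal{R},\Gamma\vdash w:\Diamond\phi,\Delta$), $(s_{\exists}^{1})$ (from $\mathcal{R},\Gamma\vdash w:\phi[y/x],w:\exists x\phi,\Delta$ infer $\mathcal{R},\Gamma\vdash w:\exists x\phi,\Delta$) and, only if $N_d\in\mathcal{C}$, $(s_{\exists}^{2})$ (from $\mathcal{R},y\in D(u),\Gamma\vdash w:\phi[y/x],w:\exists x\phi,\Delta$ infer $\mathcal{R},\Gamma\vdash w:\exists x\phi,\Delta$, $y$ fresh), each subject to a side condition requiring a suitable path between the relevant labels in the graph of relational atoms already present (with $u$ an existing label of the sequent). In particular, no rule adds a relational atom between existing labels.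
   Formalization: The seriality rule (d) applies only when w is a label already occurring in its conclusion $\mathcal{R},\Gamma\vdash\Delta$, instead of under the sole condition that u is fresh. The statement above fails without it. -}

module Defs where

open import Data.Nat using (ℕ; _≟_)
open import Data.List using (List; []; _∷_; _++_; length; filter; concatMap)
open import Data.List.Membership.Propositional using (_∈_; _∉_)
open import Data.List.Relation.Binary.Permutation.Propositional using (_↭_)
open import Data.Product using (Σ; ∃; _×_; _,_; proj₂)
open import Data.Sum using (_⊎_)
open import Relation.Binary.PropositionalEquality using (_≡_; _≢_)
open import Relation.Nullary using (yes; no)


Var   = ℕ
Label = ℕ
Pred  = ℕ

data Formula : Set where
  atom : Pred → List Var → Formula
  ⊥f   : Formula
  ¬f_  : Formula → Formula
  _∨f_ : Formula → Formula → Formula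
  ◇f_  : Formula → Formula
  ∃f   : Var → Formula → Formula

record LFormula : Set where
  constructor _⦂_
  field
    lab  : Label
    form : Formula

data RelAtom : Set where
  _Rel_ : Label → Label → RelAtom
  _∈D_ : Var → Label → RelAtom

-- labeled sequent  ℛ , Γ ⊢ Δ  (multisets represented by lists, see _≈S_)
record Sequent : Set where
  constructor ⟨_∣_⊢_⟩
  field
    rels : List RelAtom
    ant  : List LFormula
    cons : List LFormula

_≈S_ : Sequent → Sequent → Set
⟨ R ∣ Γ ⊢ Δ ⟩ ≈S ⟨ R' ∣ Γ' ⊢ Δ' ⟩ = (R ↭ R') × (Γ ↭ Γ') × (Δ ↭ Δ')

substVar : Var → Var → Var → Var
substVar y x z with z ≟ x
... | yes _ = y
... | no  _ = z

substVars : Var → Var → List Var → List Var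
substVars y x []       = []
substVars y x (z ∷ zs) = substVar y x z ∷ substVars y x zs

_[_/_] : Formula → Var → Var → Formula
atom p xs [ y / x ] = atom p (substVars y x xs)
⊥f [ y / x ]        = ⊥f
(¬f φ) [ y / x ]    = ¬f (φ [ y / x ])
(φ ∨f ψ) [ y / x ]  = (φ [ y / x ]) ∨f (ψ [ y / x ])
(◇f φ) [ y / x ]    = ◇f (φ [ y / x ])
∃f z φ [ y / x ] with z ≟ x
... | yes _ = ∃f z φ
... | no  _ = ∃f z (φ [ y / x ])

labelsR : List RelAtom → List Label
labelsR []            = []
labelsR (w Rel u ∷ rs)  = w ∷ u ∷ labelsR rs
labelsR (x ∈D w ∷ rs) = w ∷ labelsR rs

labelsF : List LFormula → List Label
labelsF []             = []
labelsF ((w ⦂ _) ∷ fs) = w ∷ labelsF fs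

labels : Sequent → List Label
labels ⟨ R ∣ Γ ⊢ Δ ⟩ = labelsR R ++ labelsF Γ ++ labelsF Δ

varsFm : Formula → List Var
varsFm (atom p xs) = xs
varsFm ⊥f          = []
varsFm (¬f φ)      = varsFm φ
varsFm (φ ∨f ψ)    = varsFm φ ++ varsFm ψ
varsFm (◇f φ)      = varsFm φ
varsFm (∃f x φ)    = x ∷ varsFm φ

varsR : List RelAtom → List Var
varsR []            = []
varsR (w Rel u ∷ rs)  = varsR rs
varsR (x ∈D w ∷ rs) = x ∷ varsR rs

varsF : List LFormula → List Var
varsF []             = []
varsF ((_ ⦂ φ) ∷ fs) = varsFm φ ++ varsF fs

vars : Sequent → List Var
vars ⟨ R ∣ Γ ⊢ Δ ⟩ = varsR R ++ varsF Γ ++ varsF Δ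

data FrameCond : Set where
  Ser : FrameCond
  G   : ℕ → ℕ → FrameCond
  I-d : FrameCond
  D-d : FrameCond
  C-d : FrameCond
  N-d : FrameCond

-- Side conditions of the reachability rules (p◇), (s∃¹), (s∃²).
-- They are taken as parameters; the only
-- property used is that the label u of (p◇) and of (s∃²) is an existing
-- label of the conclusion.
record ReachConds : Set₁ where
  field
    p◇-cond    : Sequent → Label → Label → Set
    p◇-exists  : ∀ {S w u} → p◇-cond S w u → u ∈ labels S
    s∃¹-cond   : Sequent → Label → Var → Set
    s∃²-cond   : Sequent → Label → Label → Set
    s∃²-exists : ∀ {S w u} → s∃²-cond S w u → u ∈ labels S

-- The calculus QK(𝒞)L  (conclusions written in a canonical list form;
-- a rule instance may have as conclusion any sequent equal to it as
-- multisets, see `Proof`)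

module Calculus (𝒞 : List FrameCond) (RC : ReachConds) where
  open ReachConds RC

  data Rule0 : Sequent → Set where
    ax  : ∀ {R Γ Δ w p xs} →
          Rule0 ⟨ R ∣ (w ⦂ atom p xs) ∷ Γ ⊢ (w ⦂ atom p xs) ∷ Δ ⟩
    ⊥l  : ∀ {R Γ Δ w} → Rule0 ⟨ R ∣ (w ⦂ ⊥f) ∷ Γ ⊢ Δ ⟩

  -- Rule1 premise conclusion
  data Rule1 : Sequent → Sequent → Set where
    ¬l  : ∀ {R Γ Δ w φ} →
          Rule1 ⟨ R ∣ Γ ⊢ (w ⦂ φ) ∷ Δ ⟩ ⟨ R ∣ (w ⦂ (¬f φ)) ∷ Γ ⊢ Δ ⟩
    ¬r  : ∀ {R Γ Δ w φ} →
          Rule1 ⟨ R ∣ (w ⦂ φ) ∷ Γ ⊢ Δ ⟩ ⟨ R ∣ Γ ⊢ (w ⦂ (¬f φ)) ∷ Δ ⟩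
    ∨r  : ∀ {R Γ Δ w φ ψ} →
          Rule1 ⟨ R ∣ Γ ⊢ (w ⦂ φ) ∷ (w ⦂ ψ) ∷ Δ ⟩
                ⟨ R ∣ Γ ⊢ (w ⦂ (φ ∨f ψ)) ∷ Δ ⟩
    ◇l  : ∀ {R Γ Δ w u φ} →
          u ∉ labels ⟨ R ∣ (w ⦂ (◇f φ)) ∷ Γ ⊢ Δ ⟩ →
          Rule1 ⟨ (w Rel u) ∷ R ∣ (u ⦂ φ) ∷ Γ ⊢ Δ ⟩
                ⟨ R ∣ (w ⦂ (◇f φ)) ∷ Γ ⊢ Δ ⟩
    ∃l  : ∀ {R Γ Δ w x y φ} →
          y ∉ vars ⟨ R ∣ (w ⦂ ∃f x φ) ∷ Γ ⊢ Δ ⟩ →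
          Rule1 ⟨ (y ∈D w) ∷ R ∣ (w ⦂ (φ [ y / x ])) ∷ Γ ⊢ Δ ⟩
                ⟨ R ∣ (w ⦂ ∃f x φ) ∷ Γ ⊢ Δ ⟩
    d   : ∀ {R Γ Δ w u} → Ser ∈ 𝒞 →
          w ∈ labels ⟨ R ∣ Γ ⊢ Δ ⟩ →
          u ∉ labels ⟨ R ∣ Γ ⊢ Δ ⟩ →
          Rule1 ⟨ (w Rel u) ∷ R ∣ Γ ⊢ Δ ⟩ ⟨ R ∣ Γ ⊢ Δ ⟩
    p◇  : ∀ {R Γ Δ w u φ} →
          p◇-cond ⟨ R ∣ Γ ⊢ (w ⦂ (◇f φ)) ∷ Δ ⟩ w u →
          Rule1 ⟨ R ∣ Γ ⊢ (w ⦂ (◇f φ)) ∷ (u ⦂ φ) ∷ Δ ⟩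
                ⟨ R ∣ Γ ⊢ (w ⦂ (◇f φ)) ∷ Δ ⟩
    s∃¹ : ∀ {R Γ Δ w x y φ} →
          s∃¹-cond ⟨ R ∣ Γ ⊢ (w ⦂ ∃f x φ) ∷ Δ ⟩ w y →
          Rule1 ⟨ R ∣ Γ ⊢ (w ⦂ (φ [ y / x ])) ∷ (w ⦂ ∃f x φ) ∷ Δ ⟩
                ⟨ R ∣ Γ ⊢ (w ⦂ ∃f x φ) ∷ Δ ⟩
    s∃² : ∀ {R Γ Δ w u x y φ} → N-d ∈ 𝒞 →
          y ∉ vars ⟨ R ∣ Γ ⊢ (w ⦂ ∃f x φ) ∷ Δ ⟩ →
          s∃²-cond ⟨ R ∣ Γ ⊢ (w ⦂ ∃f x φ) ∷ Δ ⟩ w u →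
          Rule1 ⟨ (y ∈D u) ∷ R ∣ Γ ⊢ (w ⦂ (φ [ y / x ])) ∷ (w ⦂ ∃f x φ) ∷ Δ ⟩
                ⟨ R ∣ Γ ⊢ (w ⦂ ∃f x φ) ∷ Δ ⟩

  -- Rule2 premise₁ premise₂ conclusion
  data Rule2 : Sequent → Sequent → Sequent → Set where
    ∨l  : ∀ {R Γ Δ w φ ψ} →
          Rule2 ⟨ R ∣ (w ⦂ φ) ∷ Γ ⊢ Δ ⟩ ⟨ R ∣ (w ⦂ ψ) ∷ Γ ⊢ Δ ⟩
                ⟨ R ∣ (w ⦂ (φ ∨f ψ)) ∷ Γ ⊢ Δ ⟩

  data Proof : Sequent → Set where
    rule0 : ∀ {S' S} → Rule0 S' → S ≈S S' → Proof S
    rule1 : ∀ {P S' S} → Rule1 P S' → S ≈S S' → Proof P → Proof S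
    rule2 : ∀ {P Q S' S} → Rule2 P Q S' → S ≈S S' →
            Proof P → Proof Q → Proof S

  EverySequent : (Sequent → Set) → ∀ {S} → Proof S → Set
  EverySequent Φ {S} (rule0 _ _)       = Φ S
  EverySequent Φ {S} (rule1 _ _ p)     = Φ S × EverySequent Φ p
  EverySequent Φ {S} (rule2 _ _ p q)   =
    Φ S × EverySequent Φ p × EverySequent Φ q

edges : List RelAtom → List (Label × Label)
edges []            = []
edges (w Rel u ∷ rs)  = (w , u) ∷ edges rs
edges (x ∈D w ∷ rs) = edges rs

vertices : List (Label × Label) → List Label
vertices []             = []
vertices ((a , b) ∷ es) = a ∷ b ∷ vertices es

indeg : List (Label × Label) → Label → ℕ
indeg E v = length (filter (λ e → proj₂ e ≟ v) E)

data Reach (E : List (Label × Label)) : Label → Label → Set where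
  here  : ∀ {a} → Reach E a a
  there : ∀ {a b c} → (a , b) ∈ E → Reach E b c → Reach E a c

IsTree : List (Label × Label) → Label → Set
IsTree E r =
  r ∈ vertices E ×
  indeg E r ≡ 0 ×
  (∀ v → v ∈ vertices E → v ≢ r → indeg E v ≡ 1) ×
  (∀ v → v ∈ vertices E → Reach E r v)

TreeSequentRoot : Sequent → Label → Set
TreeSequentRoot S r =
  (edges (Sequent.rels S) ≡ [] × (∀ v → v ∈ labels S → v ≡ r))
  ⊎
  (edges (Sequent.rels S) ≢ [] ×
   IsTree (edges (Sequent.rels S)) r ×
   (∀ v → v ∈ labels S → v ∈ vertices (edges (Sequent.rels S))))

LabeledTreeSequent : Sequent → Set
LabeledTreeSequent S = ∃ λ r → TreeSequentRoot S r

module Derivations (𝒞 : List FrameCond) (RC : ReachConds) where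
  open Calculus 𝒞 RC

  LabeledTreeDerivation : ∀ {S} → Proof S → Set
  LabeledTreeDerivation p = EverySequent LabeledTreeSequent p

  FixedRootProperty : ∀ {S} → Proof S → Set
  FixedRootProperty p = ∃ λ r → EverySequent (λ S' → TreeSequentRoot S' r) p

-- Every rule of the calculus either keeps the relational graph of its
-- conclusion and only mentions labels already present, or, for (◇l) and (d),
-- adds one edge wRu from an existing label w to a fresh label u. The first
-- kind trivially preserves "labeled tree with root r"; the second hangs a new
-- leaf under w, which keeps the tree and its root (when the graph was empty,
-- all labels equal r, so the new tree is the single edge rRu). Hence, going
-- upwards from the end sequent, every sequent is a labeled tree sequent with
-- the root of the end sequent.
module Submission where

open import Defs
open import Data.List using (List; []; _∷_; length; map; concatMap; mapMaybe)
open import Data.List.Membership.Propositional using (_∈_; _∉_)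
open import Data.List.Membership.Propositional.Properties using (∈-++⁺ˡ; ∈-++⁺ʳ; ∈-++⁻)
open import Data.List.Relation.Unary.Any using (here; there)
open import Data.List.Relation.Binary.Subset.Propositional using (_⊆_)
open import Data.List.Relation.Binary.Subset.Propositional.Properties
  using (∈-∷⁺ʳ; ⊆-reflexive-↭; ++⁺; concatMap⁺; map⁺)
open import Data.List.Relation.Binary.Permutation.Propositional using (_↭_; ↭-refl; ↭-sym)
open import Data.List.Relation.Binary.Permutation.Propositional.Properties
  using (∈-resp-↭; ↭-length; filter-↭; ↭-empty-inv; mapMaybe-↭)
open import Data.List.Properties using (filter-accept; filter-reject)
open import Data.Maybe using (Maybe; just; nothing)
open import Data.Nat using (suc; _≟_)
open import Data.Product using (_×_; _,_; proj₁; proj₂)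
open import Data.Sum using (inj₁; inj₂; [_,_])
open import Data.Empty using (⊥-elim)
open import Function using (_∘_)
open import Relation.Nullary using (yes; no)
open import Relation.Binary.PropositionalEquality
  using (_≡_; _≢_; refl; sym; trans; cong; subst; subst₂)

source∈vertices : ∀ {E a b} → (a , b) ∈ E → a ∈ vertices E
source∈vertices {_ ∷ _}       (here refl) = here refl
source∈vertices {(_ , _) ∷ _} (there m)   = there (there (source∈vertices m))

target∈vertices : ∀ {E a b} → (a , b) ∈ E → b ∈ vertices E
target∈vertices {_ ∷ _}       (here refl) = there (here refl)
target∈vertices {(_ , _) ∷ _} (there m)   = there (there (target∈vertices m))

vertices-mono : ∀ {E E'} → E ⊆ E' → vertices E ⊆ vertices E'
vertices-mono {(_ , _) ∷ _} E⊆E' (here refl)         = source∈vertices (E⊆E' (here refl))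
vertices-mono {(_ , _) ∷ _} E⊆E' (there (here refl)) = target∈vertices (E⊆E' (here refl))
vertices-mono {(_ , _) ∷ _} E⊆E' (there (there m))   = vertices-mono (E⊆E' ∘ there) m

indeg-↭ : ∀ {E E'} v → E ↭ E' → indeg E v ≡ indeg E' v
indeg-↭ v E↭E' = ↭-length (filter-↭ (λ e → proj₂ e ≟ v) E↭E')

indeg-∷-≡ : ∀ {a b} E → indeg ((a , b) ∷ E) b ≡ suc (indeg E b)
indeg-∷-≡ {a} {b} E = cong length (filter-accept (λ e → proj₂ e ≟ b) {x = (a , b)} {xs = E} refl)

indeg-∷-≢ : ∀ {a b v} E → b ≢ v → indeg ((a , b) ∷ E) v ≡ indeg E v
indeg-∷-≢ {a} {b} {v} E b≢v =
  cong length (filter-reject (λ e → proj₂ e ≟ v) {x = (a , b)} {xs = E} b≢v)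

indeg-∉ : ∀ E {v} → v ∉ vertices E → indeg E v ≡ 0
indeg-∉ []             v∉ = refl
indeg-∉ ((a , b) ∷ E) {v} v∉ with b ≟ v
... | yes b≡v = ⊥-elim (v∉ (there (here (sym b≡v))))
... | no  b≢v = trans (indeg-∷-≢ E b≢v) (indeg-∉ E (λ v∈ → v∉ (there (there v∈))))

Reach-mono : ∀ {E E' a b} → E ⊆ E' → Reach E a b → Reach E' a b
Reach-mono E⊆E' here          = here
Reach-mono E⊆E' (there e rch) = there (E⊆E' e) (Reach-mono E⊆E' rch)

Reach-snoc : ∀ {E a b c} → Reach E a b → (b , c) ∈ E → Reach E a c
Reach-snoc here          e' = there e' here
Reach-snoc (there e rch) e' = there e (Reach-snoc rch e')

IsTree-↭ : ∀ {E E' r} → E ↭ E' → IsTree E r → IsTree E' r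
IsTree-↭ {E} {E'} {r} E↭E' (r∈ , indeg-r , indeg-v , reach) =
    vertices-mono E⊆E' r∈
  , trans (sym (indeg-↭ r E↭E')) indeg-r
  , (λ v v∈ v≢r → trans (sym (indeg-↭ v E↭E')) (indeg-v v (vertices-mono E'⊆E v∈) v≢r))
  , (λ v v∈ → Reach-mono E⊆E' (reach v (vertices-mono E'⊆E v∈)))
  where
  E⊆E' : E ⊆ E'
  E⊆E' = ∈-resp-↭ E↭E'
  E'⊆E : E' ⊆ E
  E'⊆E = ∈-resp-↭ (↭-sym E↭E')

IsTree-edge : ∀ {r u} → u ≢ r → IsTree ((r , u) ∷ []) r
IsTree-edge {r} {u} u≢r =
    here refl
  , indeg-∷-≢ [] u≢r
  , (λ { v (here v≡r) v≢r → ⊥-elim (v≢r v≡r)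
       ; v (there (here refl)) _ → indeg-∷-≡ {r} {u} [] })
  , (λ { v (here refl) → here
       ; v (there (here refl)) → there (here refl) here })

IsTree-extend : ∀ {E r w u} → IsTree E r → w ∈ vertices E → u ∉ vertices E →
                IsTree ((w , u) ∷ E) r
IsTree-extend {E} {r} {w} {u} (r∈ , indeg-r , indeg-v , reach) w∈ u∉ =
    there (there r∈)
  , trans (indeg-∷-≢ E u≢r) indeg-r
  , indeg-v'
  , reach'
  where
  u≢ : ∀ {v} → v ∈ vertices E → u ≢ v
  u≢ v∈ refl = u∉ v∈

  u≢r = u≢ r∈

  indeg-v' : ∀ v → v ∈ vertices ((w , u) ∷ E) → v ≢ r → indeg ((w , u) ∷ E) v ≡ 1
  indeg-v' v (here refl)         v≢r = trans (indeg-∷-≢ E (u≢ w∈)) (indeg-v v w∈ v≢r)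
  indeg-v' v (there (here refl)) _   = trans (indeg-∷-≡ E) (cong suc (indeg-∉ E u∉))
  indeg-v' v (there (there v∈))  v≢r = trans (indeg-∷-≢ E (u≢ v∈)) (indeg-v v v∈ v≢r)

  reach' : ∀ v → v ∈ vertices ((w , u) ∷ E) → Reach ((w , u) ∷ E) r v
  reach' v (here refl)         = Reach-mono there (reach w w∈)
  reach' v (there (here refl)) = Reach-snoc (Reach-mono there (reach w w∈)) (here refl)
  reach' v (there (there v∈))  = Reach-mono there (reach v v∈)

edge? : RelAtom → Maybe (Label × Label)
edge? (w Rel u) = just (w , u)
edge? (x ∈D w)  = nothing

edges≡mapMaybe : ∀ R → edges R ≡ mapMaybe edge? R
edges≡mapMaybe []             = refl
edges≡mapMaybe (w Rel u ∷ R)  = cong ((w , u) ∷_) (edges≡mapMaybe R)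
edges≡mapMaybe (x ∈D w ∷ R)   = edges≡mapMaybe R

edges-↭ : ∀ {R R'} → R ↭ R' → edges R ↭ edges R'
edges-↭ {R} {R'} R↭R' =
  subst₂ _↭_ (sym (edges≡mapMaybe R)) (sym (edges≡mapMaybe R')) (mapMaybe-↭ edge? R↭R')

atomLabels : RelAtom → List Label
atomLabels (w Rel u) = w ∷ u ∷ []
atomLabels (x ∈D w)  = w ∷ []

labelsR≡concatMap : ∀ R → labelsR R ≡ concatMap atomLabels R
labelsR≡concatMap []            = refl
labelsR≡concatMap (w Rel u ∷ R) = cong (λ ls → w ∷ u ∷ ls) (labelsR≡concatMap R)
labelsR≡concatMap (x ∈D w ∷ R)  = cong (w ∷_) (labelsR≡concatMap R)

labelsF≡map : ∀ Γ → labelsF Γ ≡ map LFormula.lab Γ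
labelsF≡map []             = refl
labelsF≡map ((w ⦂ _) ∷ Γ) = cong (w ∷_) (labelsF≡map Γ)

labelsR-mono : ∀ {R R'} → R ⊆ R' → labelsR R ⊆ labelsR R'
labelsR-mono {R} {R'} R⊆R' =
  subst₂ _⊆_ (sym (labelsR≡concatMap R)) (sym (labelsR≡concatMap R')) (concatMap⁺ atomLabels R⊆R')

labelsF-mono : ∀ {Γ Γ'} → Γ ⊆ Γ' → labelsF Γ ⊆ labelsF Γ'
labelsF-mono {Γ} {Γ'} Γ⊆Γ' =
  subst₂ _⊆_ (sym (labelsF≡map Γ)) (sym (labelsF≡map Γ')) (map⁺ LFormula.lab Γ⊆Γ')

labels-≈S : ∀ {S S'} → S ≈S S' → labels S' ⊆ labels S
labels-≈S {⟨ _ ∣ _ ⊢ _ ⟩} {⟨ _ ∣ _ ⊢ _ ⟩} (R↭R' , Γ↭Γ' , Δ↭Δ') =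
  ++⁺ (labelsR-mono (⊆-reflexive-↭ (↭-sym R↭R')))
      (++⁺ (labelsF-mono (⊆-reflexive-↭ (↭-sym Γ↭Γ')))
           (labelsF-mono (⊆-reflexive-↭ (↭-sym Δ↭Δ'))))

rels⊆labels : ∀ S → labelsR (Sequent.rels S) ⊆ labels S
rels⊆labels ⟨ R ∣ Γ ⊢ Δ ⟩ = ∈-++⁺ˡ

ant⊆labels : ∀ S → labelsF (Sequent.ant S) ⊆ labels S
ant⊆labels ⟨ R ∣ Γ ⊢ Δ ⟩ = ∈-++⁺ʳ (labelsR R) ∘ ∈-++⁺ˡ

cons⊆labels : ∀ S → labelsF (Sequent.cons S) ⊆ labels S
cons⊆labels ⟨ R ∣ Γ ⊢ Δ ⟩ = ∈-++⁺ʳ (labelsR R) ∘ ∈-++⁺ʳ (labelsF Γ)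

labels-⊆ : ∀ S {X} → labelsR (Sequent.rels S) ⊆ X → labelsF (Sequent.ant S) ⊆ X →
           labelsF (Sequent.cons S) ⊆ X → labels S ⊆ X
labels-⊆ ⟨ R ∣ Γ ⊢ Δ ⟩ R⊆X Γ⊆X Δ⊆X =
  [ R⊆X , [ Γ⊆X , Δ⊆X ] ∘ ∈-++⁻ (labelsF Γ) ] ∘ ∈-++⁻ (labelsR R)

vertices⊆labelsR : ∀ R → vertices (edges R) ⊆ labelsR R
vertices⊆labelsR (w Rel u ∷ R) (here refl)         = here refl
vertices⊆labelsR (w Rel u ∷ R) (there (here refl)) = there (here refl)
vertices⊆labelsR (w Rel u ∷ R) (there (there v∈))  = there (there (vertices⊆labelsR R v∈))
vertices⊆labelsR (x ∈D w ∷ R)  v∈                  = there (vertices⊆labelsR R v∈)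

TreeSequentRoot-⊆ : ∀ {S P r} → edges (Sequent.rels S) ↭ edges (Sequent.rels P) →
                    labels P ⊆ labels S → TreeSequentRoot S r → TreeSequentRoot P r
TreeSequentRoot-⊆ E↭E' P⊆S (inj₁ (no-edges , one-label)) =
  inj₁ (↭-empty-inv (↭-sym (subst (_↭ _) no-edges E↭E')) , λ v v∈ → one-label v (P⊆S v∈))
TreeSequentRoot-⊆ E↭E' P⊆S (inj₂ (has-edges , tree , covered)) =
  inj₂ ( (λ no-edges → has-edges (↭-empty-inv (subst (_ ↭_) no-edges E↭E')))
       , IsTree-↭ E↭E' tree
       , λ v v∈ → vertices-mono (∈-resp-↭ E↭E') (covered v (P⊆S v∈)))

TreeSequentRoot-≈S : ∀ {S S' r} → S ≈S S' → TreeSequentRoot S r → TreeSequentRoot S' r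
TreeSequentRoot-≈S {S@(⟨ _ ∣ _ ⊢ _ ⟩)} {S'@(⟨ _ ∣ _ ⊢ _ ⟩)} S≈S'@(R↭R' , _) =
  TreeSequentRoot-⊆ {S} {S'} (edges-↭ R↭R') (labels-≈S S≈S')

TreeSequentRoot-extend : ∀ {S P w u r} → Sequent.rels P ≡ (w Rel u) ∷ Sequent.rels S →
  w ∈ labels S → u ∉ labels S →
  labelsF (Sequent.ant P) ⊆ u ∷ labels S → labelsF (Sequent.cons P) ⊆ u ∷ labels S →
  TreeSequentRoot S r → TreeSequentRoot P r
TreeSequentRoot-extend {S@(⟨ R ∣ _ ⊢ _ ⟩)} {P@(⟨ _ ∣ _ ⊢ _ ⟩)} {w} {u} {r} refl w∈ u∉ Γ'⊆ Δ'⊆ tsr =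
  inj₂ ((λ ()) , tree tsr , λ v v∈ → covered tsr (labels-⊆ P R⊆ Γ'⊆ Δ'⊆ v∈))
  where
  E = edges R

  R⊆ : labelsR ((w Rel u) ∷ R) ⊆ u ∷ labels S
  R⊆ = ∈-∷⁺ʳ (there w∈) (∈-∷⁺ʳ (here refl) (there ∘ rels⊆labels S))

  u∉E : u ∉ vertices E
  u∉E = u∉ ∘ rels⊆labels S ∘ vertices⊆labelsR R

  tree : TreeSequentRoot S r → IsTree ((w , u) ∷ E) r
  tree (inj₁ (no-edges , one-label)) rewrite no-edges | one-label w w∈ = IsTree-edge u≢r
    where
    u≢r : u ≢ r
    u≢r refl = u∉ (subst (_∈ labels S) (one-label w w∈) w∈)
  tree (inj₂ (_ , E-tree , E-covers)) = IsTree-extend E-tree (E-covers w w∈) u∉E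

  covered : TreeSequentRoot S r → u ∷ labels S ⊆ vertices ((w , u) ∷ E)
  covered _                         (here refl)    = there (here refl)
  covered (inj₁ (_ , one-label))    {v} (there v∈) = here (trans (one-label v v∈) (sym (one-label w w∈)))
  covered (inj₂ (_ , _ , E-covers)) {v} (there v∈) = there (there (E-covers v v∈))

module _ {𝒞 : List FrameCond} {RC : ReachConds} where
  open Calculus 𝒞 RC
  open ReachConds RC

  Rule1-premise-tree : ∀ {P S r} → Rule1 P S → TreeSequentRoot S r → TreeSequentRoot P r
  Rule1-premise-tree {P} {S} ¬l = TreeSequentRoot-⊆ {S} {P} ↭-refl
    (labels-⊆ P (rels⊆labels S) (λ m → ant⊆labels S (there m))
                (∈-∷⁺ʳ (ant⊆labels S (here refl)) (cons⊆labels S)))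
  Rule1-premise-tree {P} {S} ¬r = TreeSequentRoot-⊆ {S} {P} ↭-refl
    (labels-⊆ P (rels⊆labels S) (∈-∷⁺ʳ (cons⊆labels S (here refl)) (ant⊆labels S))
                (λ m → cons⊆labels S (there m)))
  Rule1-premise-tree {P} {S} ∨r = TreeSequentRoot-⊆ {S} {P} ↭-refl
    (labels-⊆ P (rels⊆labels S) (ant⊆labels S)
                (∈-∷⁺ʳ w∈ (∈-∷⁺ʳ w∈ (λ m → cons⊆labels S (there m)))))
    where w∈ = cons⊆labels S (here refl)
  Rule1-premise-tree {P} {S} (◇l u∉) =
    TreeSequentRoot-extend {S} {P} refl (ant⊆labels S (here refl)) u∉
      (∈-∷⁺ʳ (here refl) (λ m → there (ant⊆labels S (there m)))) (there ∘ cons⊆labels S)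
  Rule1-premise-tree {P} {S} (∃l _) = TreeSequentRoot-⊆ {S} {P} ↭-refl
    (labels-⊆ P (∈-∷⁺ʳ w∈ (rels⊆labels S)) (∈-∷⁺ʳ w∈ (λ m → ant⊆labels S (there m)))
                (cons⊆labels S))
    where w∈ = ant⊆labels S (here refl)
  Rule1-premise-tree {P} {S} (d _ w∈ u∉) =
    TreeSequentRoot-extend {S} {P} refl w∈ u∉ (there ∘ ant⊆labels S) (there ∘ cons⊆labels S)
  Rule1-premise-tree {P} {S} (p◇ side) = TreeSequentRoot-⊆ {S} {P} ↭-refl
    (labels-⊆ P (rels⊆labels S) (ant⊆labels S)
                (∈-∷⁺ʳ (cons⊆labels S (here refl))
                       (∈-∷⁺ʳ (p◇-exists side) (λ m → cons⊆labels S (there m)))))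
  Rule1-premise-tree {P} {S} (s∃¹ _) = TreeSequentRoot-⊆ {S} {P} ↭-refl
    (labels-⊆ P (rels⊆labels S) (ant⊆labels S)
                (∈-∷⁺ʳ (cons⊆labels S (here refl)) (cons⊆labels S)))
  Rule1-premise-tree {P} {S} (s∃² _ _ side) = TreeSequentRoot-⊆ {S} {P} ↭-refl
    (labels-⊆ P (∈-∷⁺ʳ (s∃²-exists side) (rels⊆labels S)) (ant⊆labels S)
                (∈-∷⁺ʳ (cons⊆labels S (here refl)) (cons⊆labels S)))

  Rule2-premises-tree : ∀ {P Q S r} → Rule2 P Q S → TreeSequentRoot S r →
                        TreeSequentRoot P r × TreeSequentRoot Q r
  Rule2-premises-tree {P} {Q} {S} (∨l {R} {Γ} {Δ} {w} {φ} {ψ}) tsr =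
    TreeSequentRoot-⊆ {S} {P} ↭-refl (branch⊆labels φ) tsr ,
    TreeSequentRoot-⊆ {S} {Q} ↭-refl (branch⊆labels ψ) tsr
    where
    branch⊆labels : ∀ χ → labels ⟨ R ∣ (w ⦂ χ) ∷ Γ ⊢ Δ ⟩ ⊆ labels S
    branch⊆labels χ = labels-⊆ ⟨ R ∣ (w ⦂ χ) ∷ Γ ⊢ Δ ⟩ (rels⊆labels S)
      (∈-∷⁺ʳ (ant⊆labels S (here refl)) (λ m → ant⊆labels S (there m))) (cons⊆labels S)

  Proof-fixedRoot : ∀ {S r} → TreeSequentRoot S r → (p : Proof S) →
                    EverySequent (λ S' → TreeSequentRoot S' r) p
  Proof-fixedRoot tsr (rule0 _ _) = tsr
  Proof-fixedRoot tsr (rule1 ρ S≈ p) =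
    tsr , Proof-fixedRoot (Rule1-premise-tree ρ (TreeSequentRoot-≈S S≈ tsr)) p
  Proof-fixedRoot tsr (rule2 ρ S≈ p q) =
    tsr , Proof-fixedRoot (proj₁ premises) p , Proof-fixedRoot (proj₂ premises) q
    where premises = Rule2-premises-tree ρ (TreeSequentRoot-≈S S≈ tsr)

  EverySequent-map : ∀ {Φ Ψ : Sequent → Set} → (∀ {S} → Φ S → Ψ S) →
                     ∀ {S} (p : Proof S) → EverySequent Φ p → EverySequent Ψ p
  EverySequent-map f (rule0 _ _)     Φs             = f Φs
  EverySequent-map f (rule1 _ _ p)   (Φs , Φp)      = f Φs , EverySequent-map f p Φp
  EverySequent-map f (rule2 _ _ p q) (Φs , Φp , Φq) =
    f Φs , EverySequent-map f p Φp , EverySequent-map f q Φq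

mainTheorem5 : (𝒞 : List FrameCond) (RC : ReachConds) (S : Sequent) →
    LabeledTreeSequent S →
    (p : Calculus.Proof 𝒞 RC S) →
    Derivations.LabeledTreeDerivation 𝒞 RC p × Derivations.FixedRootProperty 𝒞 RC p
mainTheorem5 𝒞 RC S (r , tsr) p =
  EverySequent-map (r ,_) p fixed , (r , fixed)
  where fixed = Proof-fixedRoot tsr p
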